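{- Let $n\ge1$ and $0\le k\le n-1$ be integers. Define $\mu:\mathcal S_{n,k+1}\to\{\sigma\in\mathcal S_n:\ell(\mathsf{srw}(\sigma))\ge n-k\}$ by $$\mu((\alpha_0,\rho))=\alpha_1\alpha_2\cdots\alpha_{n-k-m-1}\,\alpha_{n-k-1}\alpha_{n-k-2}\cdots\alpha_{n-k-m}\,\rho_1\cdots\rho_{k+1},$$ where $\alpha_0=\{\alpha_1<\cdots<\alpha_{n-k-1}\}$, $\rho=\rho_1\cdots\rho_{k+1}$ and $m=\#\{\alpha\in\alpha_0:\alpha>\rho_1\}$. Then $\mu$ is a bijection satisfying $\mathsf{des}(\mu((\alpha_0,\rho)))=\mathsf{des}((\alpha_0,\rho))$, and its inverse is the map $\nu$ given, for $\sigma=\sigma_1\cdots\sigma_n$, by $\nu(\sigma)=(\{\sigma_1,\dots,\sigma_{n-k-1}\},\sigma_{n-k}\cdots\sigma_n)$.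
   Context: $[n]=\{1,\dots,n\}$. $\mathcal S_{n,k+1}$ is the set of pairs $(\alpha_0,\rho)$ where $\rho=\rho_1\cdots\rho_{k+1}$ is a word of $k+1$ distinct elements of $[n]$ and $\alpha_0=[n]\setminus\{\rho_1,\dots,\rho_{k+1}\}$, with $\mathsf{des}((\alpha_0,\rho))=\#\{j\in[k]:\rho_j>\rho_{j+1}\}+\#\{a\in\alpha_0:a>\rho_1\}$. Permutations in $\mathcal S_n$ are identified with words $\sigma_1\cdots\sigma_n$, and for a word $u=u_1\cdots u_\ell$, $\mathsf{des}(u)=\#\{j\in[\ell-1]:u_j>u_{j+1}\}$. $\ell(u)$ denotes the length of a word. Special reverse wave of a nonempty word $w=w_1\cdots w_\ell$ with distinct positive entries: if $w$ is increasing, $\mathsf{srw}(w)=w$; otherwise let $t$ be minimal with $w_t>w_{t+1}$, set $w_0=0$, let $s$ be maximal with $t\le s\le\ell$ and $w_t>w_{t+1}>\cdots>w_s>w_{t-1}$, and put $\mathsf{srw}(w)=w_1\cdots w_s$. -}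

module Defs where

open import Data.Nat using (ℕ; zero; suc; _+_; _∸_; _≤_; _<_; _<?_; _<ᵇ_)
open import Data.Nat.Properties using (_≟_; ≤-decTotalOrder)
open import Data.Bool using (Bool; true; false; if_then_else_; _∧_)
open import Data.List using (List; []; _∷_; _++_; length; filter; map; upTo; take; drop; reverse)
open import Data.List.Membership.Propositional using (_∈_)
open import Data.List.Membership.DecPropositional _≟_ using (_∈?_)
open import Data.List.Relation.Unary.All using (All)
open import Data.List.Relation.Unary.Unique.Propositional using (Unique)
open import Data.List.Relation.Binary.Permutation.Propositional using (_↭_)
open import Data.List.Sort.MergeSort ≤-decTotalOrder using (sort)
open import Data.Product using (_×_; _,_)
open import Relation.Binary.PropositionalEquality using (_≡_)
open import Relation.Nullary.Decidable using (¬?)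

range : ℕ → List ℕ
range n = map suc (upTo n)

-- Sets of naturals are encoded canonically as strictly increasing lists.
-- Complement [n] ∖ {ρ₁,…} as increasing list
compl : ℕ → List ℕ → List ℕ
compl n ρ = filter (λ a → ¬? (a ∈? ρ)) (range n)

Pair : Set
Pair = List ℕ × List ℕ

InS : ℕ → ℕ → Pair → Set
InS n j (α₀ , ρ) = length ρ ≡ j × Unique ρ × All (_∈ range n) ρ × α₀ ≡ compl n ρ

IsPerm : ℕ → List ℕ → Set
IsPerm n σ = σ ↭ range n

des : List ℕ → ℕ
des [] = 0
des (x ∷ []) = 0
des (x ∷ y ∷ w) = (if y <ᵇ x then 1 else 0) + des (y ∷ w)

countGt : ℕ → List ℕ → ℕ
countGt b α = length (filter (λ a → b <? a) α)

-- des of a pair; ρ₁ is the head of ρ (ρ nonempty in 𝒮_{n,k+1})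
desPair : Pair → ℕ
desPair (α₀ , []) = 0
desPair (α₀ , ρ@(r ∷ _)) = des ρ + countGt r α₀

decRun : ℕ → ℕ → List ℕ → List ℕ
decRun p last [] = []
decRun p last (y ∷ w) = if (y <ᵇ last) ∧ (p <ᵇ y) then y ∷ decRun p y w else []

-- srwAux p w : p is the previous entry (w₀ = 0 initially)
srwAux : ℕ → List ℕ → List ℕ
srwAux p [] = []
srwAux p (x ∷ []) = x ∷ []
srwAux p (x ∷ y ∷ w) = if y <ᵇ x then x ∷ decRun p x (y ∷ w) else x ∷ srwAux x (y ∷ w)

srw : List ℕ → List ℕ
srw w = srwAux 0 w

μ : Pair → List ℕ
μ (α₀ , []) = α₀
μ (α₀ , ρ@(r ∷ _)) =
  take (length α₀ ∸ countGt r α₀) α₀ ++ reverse (drop (length α₀ ∸ countGt r α₀) α₀) ++ ρ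

ν : ℕ → ℕ → List ℕ → Pair
ν n k σ = sort (take (n ∸ k ∸ 1) σ) , drop (n ∸ k ∸ 1) σ

InT : ℕ → ℕ → List ℕ → Set
InT n k σ = IsPerm n σ × (n ∸ k ≤ length (srw σ))

-- Split α₀ = L ∪ H into the elements below and above ρ₁; then m = |H| and μ(α₀, ρ) lists
-- L increasingly, then H decreasingly, then ρ. Before ρ₁ the word thus rises through L and
-- falls through H down to ρ₁, which gives |H| + des ρ descents; and srw reads past ρ₁,
-- since the falling run stays above ρ₁ > max L, so ℓ(srw) ≥ n − k. Conversely,
-- ℓ(srw σ) ≥ n − k forces σ₁ ⋯ σ_{n−k−1} into this rise-then-fall shape around σ_{n−k},
-- so sorting them and applying μ rebuilds σ.
module Submission where

open import Defs
open import Data.Bool using (true; false; _∧_)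
open import Data.Bool.Properties using (T-≡; T-∧; ¬-not)
open import Data.Empty using (⊥-elim)
open import Data.Nat using (ℕ; suc; _+_; _∸_; _≤_; _<_; _>_; _<ᵇ_; _<?_; z<s; s<s; s<s⁻¹)
open import Data.Nat.Properties
open import Data.List using (List; []; _∷_; _++_; length; filter; take; drop; reverse; upTo)
open import Data.List.Properties using (++-assoc; ++-identityʳ; length-++; length-reverse; length-drop; length-take; length-map; length-upTo; take++drop≡id; drop-all; reverse-involutive; unfold-reverse; filter-++; filter-all; filter-none)
open import Data.List.Membership.Propositional using (_∈_; _∉_)
open import Data.List.Membership.Propositional.Properties using (∈-++⁺ˡ; ∈-++⁺ʳ; ∈-++⁻; ∈-filter⁺; ∈-filter⁻)
open import Data.List.Membership.DecPropositional _≟_ using (_∈?_)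
open import Data.List.Membership.Propositional.Properties.WithK using (unique∧set⇒bag)
open import Data.List.Relation.Binary.BagAndSetEquality using (∼bag⇒↭)
open import Data.List.Relation.Binary.Permutation.Propositional using (_↭_; ↭-sym; ↭-trans; ↭-reflexive; ↭⇒↭ₛ)
open import Data.List.Relation.Binary.Permutation.Propositional.Properties using (∈-resp-↭; All-resp-↭; ↭-length; ↭-reverse; ++⁺ˡ; ++⁺ʳ)
open import Data.List.Relation.Binary.Permutation.Setoid.Properties using (Unique-resp-↭)
open import Data.List.Relation.Binary.Equality.Propositional using (≋⇒≡)
open import Data.List.Relation.Unary.Any using (here; there)
open import Data.List.Relation.Unary.All as All using (All; []; _∷_)
import Data.List.Relation.Unary.All.Properties as Allₚ
open import Data.List.Relation.Unary.AllPairs as AllPairs using (AllPairs; []; _∷_)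
import Data.List.Relation.Unary.AllPairs.Properties as AllPairsₚ
open import Data.List.Relation.Unary.Unique.Propositional using (Unique)
import Data.List.Relation.Unary.Unique.Propositional.Properties as Uniqueₚ
open import Data.List.Relation.Unary.Linked.Properties using (AllPairs⇒Linked)
open import Data.List.Relation.Unary.Sorted.TotalOrder.Properties using (↗↭↗⇒≋)
open import Data.List.Sort.Base using (SortingAlgorithm)
open import Data.List.Sort.MergeSort ≤-decTotalOrder using (sort; mergeSort)
open import Data.Product as Product using (_×_; _,_; proj₁; proj₂; ∃₂)
open import Data.Sum using (_⊎_; inj₁; inj₂)
open import Function using (id; _∘_; flip)
open import Function.Bundles using (Equivalence; mk⇔)
open import Relation.Binary.Core using (Rel)
open import Relation.Binary.Definitions using (tri<; tri≈; tri>)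
open import Relation.Binary.PropositionalEquality
open import Relation.Nullary using (¬_; yes; no)
open import Relation.Nullary.Decidable using (¬?)

open SortingAlgorithm mergeSort using (sort-↭; sort-↗)

Increasing Decreasing : List ℕ → Set
Increasing = AllPairs _<_
Decreasing = AllPairs _>_

<ᵇ-true : ∀ {m n} → m < n → (m <ᵇ n) ≡ true
<ᵇ-true m<n = Equivalence.to T-≡ (<⇒<ᵇ m<n)

<ᵇ-false : ∀ {m n} → ¬ m < n → (m <ᵇ n) ≡ false
<ᵇ-false {m} {n} m≮n = ¬-not (m≮n ∘ <ᵇ⇒< m n ∘ Equivalence.from T-≡)

∸-pivot : ∀ {c k n} → c + suc k ≡ n → n ∸ k ≡ suc c
∸-pivot {c} {k} refl = trans (cong (_∸ k) (+-suc c k)) (m+n∸n≡m (suc c) k)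

∸-complement : ∀ {c k n} → c + suc k ≡ n → n ∸ c ≡ suc k
∸-complement {c} {k} refl = m+n∸m≡n c (suc k)

pivot-split : ∀ {n k} → k < n → n ∸ k ∸ 1 + suc k ≡ n
pivot-split {n} {k} k<n =
  subst (λ c → c + suc k ≡ n) (sym (cong (_∸ 1) (∸-pivot split))) split
  where
  split = m∸n+n≡m k<n

module _ {a} {A : Set a} where

  take-++ : ∀ (u : List A) {v i} → length u ≡ i → take i (u ++ v) ≡ u
  take-++ []      refl = refl
  take-++ (x ∷ u) refl = cong (x ∷_) (take-++ u refl)

  drop-++ : ∀ (u : List A) {v i} → length u ≡ i → drop i (u ++ v) ≡ v
  drop-++ []      refl = refl
  drop-++ (x ∷ u) refl = drop-++ u refl

  -- All P (take 1 w): P holds of the first letter of w, vacuously if w = [].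
  head-++ : ∀ {p} {P : A → Set p} u {v} → All P u → All P (take 1 v) → All P (take 1 (u ++ v))
  head-++ []      _        Pv = Pv
  head-++ (x ∷ u) (Px ∷ _) _  = Px ∷ []

  length-∷⁺ : ∀ {i x} {s t : List A} → s ≡ x ∷ t → i < length t → suc i < length s
  length-∷⁺ refl = s<s

  length-∷⁻ : ∀ {i x} {s t : List A} → s ≡ x ∷ t → suc i < length s → i < length t
  length-∷⁻ refl = s<s⁻¹

  All-reverse : ∀ {p} {P : A → Set p} {xs} → All P xs → All P (reverse xs)
  All-reverse {xs = xs} = All-resp-↭ (↭-sym (↭-reverse xs))

  unique⇒↭ : ∀ {xs ys : List A} → Unique xs → Unique ys →
             (∀ {x} → x ∈ xs → x ∈ ys) → (∀ {x} → x ∈ ys → x ∈ xs) → xs ↭ ys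
  unique⇒↭ u v ⊆ ⊇ = ∼bag⇒↭ (unique∧set⇒bag u v (mk⇔ ⊆ ⊇))

  module _ {ℓ} {R : Rel A ℓ} where

    AllPairs-++⁻ : ∀ xs {ys} → AllPairs R (xs ++ ys) →
                   AllPairs R xs × AllPairs R ys × All (λ x → All (R x) ys) xs
    AllPairs-++⁻ []       Rys          = [] , Rys , []
    AllPairs-++⁻ (x ∷ xs) (Rx ∷ Rxsys) with AllPairs-++⁻ xs Rxsys
    ... | Rxs , Rys , Rxsys′ = Allₚ.++⁻ˡ xs Rx ∷ Rxs , Rys , Allₚ.++⁻ʳ xs Rx ∷ Rxsys′

    AllPairs-reverse : ∀ {xs} → AllPairs R xs → AllPairs (flip R) (reverse xs)
    AllPairs-reverse {[]}     []         = []
    AllPairs-reverse {x ∷ xs} (Rx ∷ Rxs) rewrite unfold-reverse x xs =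
      AllPairsₚ.++⁺ (AllPairs-reverse Rxs) ([] ∷ []) (All.map (_∷ []) (All-reverse Rx))

head-compare : ∀ {x} w → All (x ≢_) (take 1 w) → All (_< x) (take 1 w) ⊎ All (x <_) (take 1 w)
head-compare []      []          = inj₁ []
head-compare (y ∷ _) (x≢y ∷ []) with <-cmp y _
... | tri< y<x _ _ = inj₁ (y<x ∷ [])
... | tri≈ _ y≡x _ = ⊥-elim (x≢y (sym y≡x))
... | tri> _ _ x<y = inj₂ (x<y ∷ [])

increasing⇒unique : ∀ {xs} → Increasing xs → Unique xs
increasing⇒unique = AllPairs.map <⇒≢

increasing-∷ : ∀ {p x xs} → p < x → Increasing (x ∷ xs) → Increasing (p ∷ x ∷ xs)
increasing-∷ p<x inc@(x<xs ∷ _) = (p<x ∷ All.map (<-trans p<x) x<xs) ∷ inc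

decreasing-∷ : ∀ {l x xs} → x < l → Decreasing (x ∷ xs) → Decreasing (l ∷ x ∷ xs)
decreasing-∷ x<l dec@(xs<x ∷ _) = (x<l ∷ All.map (λ y<x → <-trans y<x x<l) xs<x) ∷ dec

pivot-bounds : ∀ L {r H} → Increasing (L ++ r ∷ H) → All (_< r) L × All (r <_) H
pivot-bounds L inc with AllPairs-++⁻ L inc
... | _ , r<H ∷ _ , L<rH = All.map All.head L<rH , r<H

increasing-without-pivot : ∀ L {r H} → Increasing (L ++ r ∷ H) → Increasing (L ++ H)
increasing-without-pivot L inc with AllPairs-++⁻ L inc
... | incL , _ ∷ incH , L<rH = AllPairsₚ.++⁺ incL incH (All.map All.tail L<rH)

-- Increasing (p ∷ L ++ r ∷ H) says p < L < r < H with L and H increasing; the bound p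
-- stands for the letter srw compares against (the previous entry, initially w₀ = 0).
increasing-split : ∀ {p r} α → Increasing (p ∷ α) → p < r → r ∉ α →
                   ∃₂ λ L H → α ≡ L ++ H × Increasing (p ∷ L ++ r ∷ H)
increasing-split []      _                   p<r _  = [] , [] , refl , (p<r ∷ []) ∷ [] ∷ []
increasing-split {r = r} (a ∷ α) ((p<a ∷ _) ∷ inc) p<r r∉ with <-cmp a r
... | tri< a<r _ _ with increasing-split α inc a<r (r∉ ∘ there)
...   | L , H , α≡ , inc′ = a ∷ L , H , cong (a ∷_) α≡ , increasing-∷ p<a inc′
increasing-split (a ∷ α) _ _   r∉ | tri≈ _ a≡r _ = ⊥-elim (r∉ (here (sym a≡r)))
increasing-split (a ∷ α) (_ ∷ inc) p<r _ | tri> _ _ r<a =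
  [] , a ∷ α , refl , increasing-∷ p<r (increasing-∷ r<a inc)

sort-↭-increasing : ∀ {A B} → A ↭ B → Increasing B → sort A ≡ B
sort-↭-increasing {A} A↭B incB = ≋⇒≡ (↗↭↗⇒≋ ≤-totalOrder (sort-↗ A)
  (AllPairs⇒Linked (AllPairs.map <⇒≤ incB)) (↭⇒↭ₛ (↭-trans (sort-↭ A) A↭B)))

range-increasing : ∀ n → Increasing (range n)
range-increasing n = AllPairsₚ.map⁺ (AllPairsₚ.applyUpTo⁺₁ id n (λ i<j _ → s<s i<j))

range-positive : ∀ n → All (0 <_) (range n)
range-positive n = Allₚ.map⁺ (All.universal (λ _ → z<s) (upTo n))

length-range : ∀ n → length (range n) ≡ n
length-range n = trans (length-map suc (upTo n)) (length-upTo n)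

length-↭-range : ∀ {n σ} → σ ↭ range n → length σ ≡ n
length-↭-range {n} σ↭ = trans (↭-length σ↭) (length-range n)

↭-range⇒unique : ∀ {n σ} → σ ↭ range n → Unique σ
↭-range⇒unique {n} σ↭ =
  Unique-resp-↭ (setoid ℕ) (↭⇒↭ₛ (↭-sym σ↭)) (increasing⇒unique (range-increasing n))

∈-compl⁻ : ∀ {n ρ x} → x ∈ compl n ρ → x ∈ range n × x ∉ ρ
∈-compl⁻ {n} {ρ} = ∈-filter⁻ (λ a → ¬? (a ∈? ρ)) {xs = range n}

∈-compl⁺ : ∀ {n ρ x} → x ∈ range n → x ∉ ρ → x ∈ compl n ρ
∈-compl⁺ {ρ = ρ} = ∈-filter⁺ (λ a → ¬? (a ∈? ρ))

compl-increasing : ∀ n ρ → Increasing (0 ∷ compl n ρ)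
compl-increasing n ρ =
  Allₚ.filter⁺ P? (range-positive n) ∷ AllPairsₚ.filter⁺ P? (range-increasing n)
  where P? = λ a → ¬? (a ∈? ρ)

compl-++-↭ : ∀ n {ρ} → Unique ρ → All (_∈ range n) ρ → compl n ρ ++ ρ ↭ range n
compl-++-↭ n {ρ} u ρ⊆ = unique⇒↭ unique (increasing⇒unique (range-increasing n)) ⊆ ⊇
  where
  unique = Uniqueₚ.++⁺ (increasing⇒unique (AllPairs.tail (compl-increasing n ρ))) u
             (λ (x∈α , x∈ρ) → proj₂ (∈-compl⁻ {n} x∈α) x∈ρ)
  ⊆ : ∀ {x} → x ∈ compl n ρ ++ ρ → x ∈ range n
  ⊆ x∈ with ∈-++⁻ (compl n ρ) x∈
  ... | inj₁ x∈α = proj₁ (∈-compl⁻ x∈α)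
  ... | inj₂ x∈ρ = All.lookup ρ⊆ x∈ρ
  ⊇ : ∀ {x} → x ∈ range n → x ∈ compl n ρ ++ ρ
  ⊇ {x} x∈ with x ∈? ρ
  ... | yes x∈ρ = ∈-++⁺ʳ (compl n ρ) x∈ρ
  ... | no  x∉ρ = ∈-++⁺ˡ (∈-compl⁺ x∈ x∉ρ)

↭-range⇒↭-compl : ∀ n A {B} → A ++ B ↭ range n → A ↭ compl n B
↭-range⇒↭-compl n A {B} AB↭ with AllPairs-++⁻ A (↭-range⇒unique AB↭)
... | uA , _ , A#B = unique⇒↭ uA (increasing⇒unique (AllPairs.tail (compl-increasing n B))) ⊆ ⊇
  where
  ⊆ : ∀ {x} → x ∈ A → x ∈ compl n B
  ⊆ x∈A = ∈-compl⁺ (∈-resp-↭ AB↭ (∈-++⁺ˡ x∈A))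
            (λ x∈B → All.lookup (All.lookup A#B x∈A) x∈B refl)
  ⊇ : ∀ {x} → x ∈ compl n B → x ∈ A
  ⊇ x∈α with ∈-compl⁻ x∈α
  ... | x∈range , x∉B with ∈-++⁻ A (∈-resp-↭ (↭-sym AB↭) x∈range)
  ...   | inj₁ x∈A = x∈A
  ...   | inj₂ x∈B = ⊥-elim (x∉B x∈B)

length-compl : ∀ n {ρ} → Unique ρ → All (_∈ range n) ρ → length (compl n ρ) + length ρ ≡ n
length-compl n {ρ} u ρ⊆ =
  trans (sym (length-++ (compl n ρ))) (length-↭-range (compl-++-↭ n u ρ⊆))

sort-take≡compl-drop : ∀ {n} j {σ} → σ ↭ range n → sort (take j σ) ≡ compl n (drop j σ)
sort-take≡compl-drop {n} j {σ} σ↭ = sort-↭-increasing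
  (↭-range⇒↭-compl n (take j σ) (subst (_↭ range n) (sym (take++drop≡id j σ)) σ↭))
  (AllPairs.tail (compl-increasing n (drop j σ)))

pivot-position : ∀ {n k α ρ} → InS n (suc k) (α , ρ) → n ∸ k ≡ suc (length α)
pivot-position {n} {ρ = ρ} (len , u , ρ⊆ , refl) =
  ∸-pivot (subst (λ l → length (compl n ρ) + l ≡ n) len (length-compl n u ρ⊆))

length-drop-pivot : ∀ {n k σ} → k < n → σ ↭ range n → length (drop (n ∸ k ∸ 1) σ) ≡ suc k
length-drop-pivot {n} {k} {σ} k<n σ↭ = begin
  length (drop j σ) ≡⟨ length-drop j σ ⟩
  length σ ∸ j      ≡⟨ cong (_∸ j) (length-↭-range σ↭) ⟩
  n ∸ j             ≡⟨ ∸-complement (pivot-split k<n) ⟩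
  suc k             ∎
  where
  open ≡-Reasoning
  j = n ∸ k ∸ 1

μ-↭ : ∀ α ρ → μ (α , ρ) ↭ α ++ ρ
μ-↭ α [] = ↭-reflexive (sym (++-identityʳ α))
μ-↭ α ρ@(r ∷ _) = ↭-trans (++⁺ˡ (take m α) (++⁺ʳ ρ (↭-reverse (drop m α))))
  (↭-reflexive (trans (sym (++-assoc (take m α) (drop m α) ρ))
                       (cong (_++ ρ) (take++drop≡id m α))))
  where m = length α ∸ countGt r α

drop-μ : ∀ α ρ → drop (length α) (μ (α , ρ)) ≡ ρ
drop-μ α [] = drop-all (length α) α ≤-refl
drop-μ α ρ@(r ∷ _) =
  trans (cong (drop (length α)) (sym (++-assoc (take m α) (reverse (drop m α)) ρ)))
        (drop-++ (take m α ++ reverse (drop m α)) length≡)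
  where
  m = length α ∸ countGt r α
  length≡ : length (take m α ++ reverse (drop m α)) ≡ length α
  length≡ = trans (↭-length (++⁺ˡ (take m α) (↭-reverse (drop m α))))
                  (cong length (take++drop≡id m α))

countGt-pivot : ∀ L {r H} → Increasing (L ++ r ∷ H) → countGt r (L ++ H) ≡ length H
countGt-pivot L {r} {H} inc with pivot-bounds L inc
... | L<r , r<H = begin
  length (filter (r <?_) (L ++ H))                ≡⟨ cong length (filter-++ (r <?_) L H) ⟩
  length (filter (r <?_) L ++ filter (r <?_) H)   ≡⟨ cong₂ (λ l h → length (l ++ h))
                                                       (filter-none (r <?_) (All.map <⇒≯ L<r))
                                                       (filter-all (r <?_) r<H) ⟩
  length H                                        ∎
  where open ≡-Reasoning

μ-pivot : ∀ L H {r} ρ' → Increasing (L ++ r ∷ H) →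
          μ (L ++ H , r ∷ ρ') ≡ L ++ reverse H ++ r ∷ ρ'
μ-pivot L H {r} ρ' inc = cong₂ (λ l h → l ++ reverse h ++ r ∷ ρ') (take-++ L m≡) (drop-++ L m≡)
  where
  m≡ : length L ≡ length (L ++ H) ∸ countGt r (L ++ H)
  m≡ = sym (trans (cong₂ _∸_ (length-++ L) (countGt-pivot L inc)) (m+n∸n≡m (length L) (length H)))

des-ascent : ∀ {x} w → All (x <_) (take 1 w) → des (x ∷ w) ≡ des w
des-ascent []      []          = refl
des-ascent (y ∷ _) (x<y ∷ []) rewrite <ᵇ-false (<⇒≯ x<y) = refl

des-descent : ∀ {x y} w → y < x → des (x ∷ y ∷ w) ≡ suc (des (y ∷ w))
des-descent _ y<x rewrite <ᵇ-true y<x = refl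

des-++-increasing : ∀ L {w} → Increasing L → All (λ x → All (x <_) (take 1 w)) L →
                    des (L ++ w) ≡ des w
des-++-increasing []      _           _           = refl
des-++-increasing (x ∷ L) {w} (x<L ∷ inc) (x<w ∷ L<w) =
  trans (des-ascent (L ++ w) (head-++ L x<L x<w)) (des-++-increasing L inc L<w)

des-++-decreasing : ∀ D {r} ρ' → Decreasing D → All (r <_) D →
                    des (D ++ r ∷ ρ') ≡ length D + des (r ∷ ρ')
des-++-decreasing []           _  _                   _           = refl
des-++-decreasing (d ∷ [])     ρ' _                   (r<d ∷ [])  = des-descent ρ' r<d
des-++-decreasing (d ∷ d′ ∷ D) ρ' ((d′<d ∷ _) ∷ dec) (_ ∷ r<D) =
  trans (des-descent (D ++ _ ∷ ρ') d′<d) (cong suc (des-++-decreasing (d′ ∷ D) ρ' dec r<D))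

des-pivot : ∀ L H {r} ρ' → Increasing (L ++ r ∷ H) →
            des (L ++ reverse H ++ r ∷ ρ') ≡ length H + des (r ∷ ρ')
des-pivot L H {r} ρ' inc with AllPairs-++⁻ L inc
... | incL , r<H ∷ incH , L<rH = begin
  des (L ++ reverse H ++ r ∷ ρ')     ≡⟨ des-++-increasing L incL (All.map below-head L<rH) ⟩
  des (reverse H ++ r ∷ ρ')          ≡⟨ des-++-decreasing (reverse H) ρ' (AllPairs-reverse incH)
                                                            (All-reverse r<H) ⟩
  length (reverse H) + des (r ∷ ρ')  ≡⟨ cong (_+ des (r ∷ ρ')) (length-reverse H) ⟩
  length H + des (r ∷ ρ')            ∎
  where
  open ≡-Reasoning
  below-head : ∀ {x} → All (x <_) (r ∷ H) → All (x <_) (take 1 (reverse H ++ r ∷ ρ'))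
  below-head (x<r ∷ x<H) = head-++ (reverse H) (All-reverse x<H) (x<r ∷ [])

decRun-step : ∀ {p last y} w → y < last → p < y → decRun p last (y ∷ w) ≡ y ∷ decRun p y w
decRun-step _ y<l p<y rewrite <ᵇ-true y<l | <ᵇ-true p<y = refl

decRun-head : ∀ {p last y} w → 0 < length (decRun p last (y ∷ w)) → y < last × p < y
decRun-head {p} {last} {y} w nonempty with (y <ᵇ last) ∧ (p <ᵇ y) in accept
... | true  = Product.map (<ᵇ⇒< y last) (<ᵇ⇒< p y) (Equivalence.to T-∧ (Equivalence.from T-≡ accept))
... | false = ⊥-elim (n≮0 nonempty)

decRun-long : ∀ {p last r} B ρ' → Decreasing (last ∷ B) → All (r <_) (last ∷ B) → p < r →
              length B < length (decRun p last (B ++ r ∷ ρ'))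
decRun-long []      ρ' _                  (r<l ∷ [])        p<r =
  subst (λ s → 0 < length s) (sym (decRun-step ρ' r<l p<r)) z<s
decRun-long (b ∷ B) ρ' ((b<l ∷ _) ∷ dec) (_ ∷ r<bB@(r<b ∷ _)) p<r =
  length-∷⁺ (decRun-step (B ++ _ ∷ ρ') b<l (<-trans p<r r<b)) (decRun-long B ρ' dec r<bB p<r)

decRun-long⁻¹ : ∀ {p last r} B ρ' → length B < length (decRun p last (B ++ r ∷ ρ')) →
                Decreasing (last ∷ B) × All (r <_) (last ∷ B) × p < r
decRun-long⁻¹ [] ρ' long with decRun-head ρ' long
... | r<l , p<r = [] ∷ [] , r<l ∷ [] , p<r
decRun-long⁻¹ {p} {last} {r} (b ∷ B) ρ' long with decRun-head (B ++ r ∷ ρ') (≤-trans z<s long)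
... | b<l , p<b with decRun-long⁻¹ B ρ' (length-∷⁻ (decRun-step (B ++ r ∷ ρ') b<l p<b) long)
...   | dec , r<bB@(r<b ∷ _) , p<r = decreasing-∷ b<l dec , <-trans r<b b<l ∷ r<bB , p<r

srwAux-nonempty : ∀ p x w → 0 < length (srwAux p (x ∷ w))
srwAux-nonempty p x []      = z<s
srwAux-nonempty p x (y ∷ w) with y <ᵇ x
... | true  = z<s
... | false = z<s

srwAux-ascent : ∀ {p x} w → All (x <_) (take 1 w) → srwAux p (x ∷ w) ≡ x ∷ srwAux x w
srwAux-ascent []      []          = refl
srwAux-ascent (y ∷ _) (x<y ∷ []) rewrite <ᵇ-false (<⇒≯ x<y) = refl

srwAux-descent : ∀ {p x} w → All (_< x) (take 1 w) → srwAux p (x ∷ w) ≡ x ∷ decRun p x w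
srwAux-descent []      []          = refl
srwAux-descent (y ∷ _) (y<x ∷ []) rewrite <ᵇ-true y<x = refl

decreasing⇒srw-long : ∀ D {p r} ρ' → Decreasing D → All (r <_) D → p < r →
                      suc (length D) ≤ length (srwAux p (D ++ r ∷ ρ'))
decreasing⇒srw-long []      {p} {r} ρ' _ _ _ = srwAux-nonempty p r ρ'
decreasing⇒srw-long (d ∷ D) {p} {r} ρ' dec@(D<d ∷ _) r<dD@(r<d ∷ _) p<r =
  length-∷⁺ (srwAux-descent {p} (D ++ r ∷ ρ') (head-++ D D<d (r<d ∷ [])))
            (decRun-long D ρ' dec r<dD p<r)

pivot⇒srw-long : ∀ L H {p r} ρ' → Increasing (p ∷ L ++ r ∷ H) →
                 suc (length L + length H) ≤ length (srwAux p (L ++ reverse H ++ r ∷ ρ'))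
pivot⇒srw-long [] H {p} {r} ρ' ((p<r ∷ _) ∷ r<H ∷ incH) =
  subst (λ l → suc l ≤ length (srwAux p (reverse H ++ r ∷ ρ'))) (length-reverse H)
    (decreasing⇒srw-long (reverse H) ρ' (AllPairs-reverse incH) (All-reverse r<H) p<r)
pivot⇒srw-long (x ∷ L) H {p} {r} ρ' (_ ∷ inc@(x<LrH ∷ _)) with Allₚ.++⁻ L x<LrH
... | x<L , x<r ∷ x<H =
  length-∷⁺ (srwAux-ascent {p} (L ++ reverse H ++ r ∷ ρ') x<next) (pivot⇒srw-long L H ρ' inc)
  where x<next = head-++ L x<L (head-++ (reverse H) (All-reverse x<H) (x<r ∷ []))

srw-long⇒pivot : ∀ A {p r} ρ' → Unique (A ++ r ∷ ρ') → All (p <_) (take 1 (A ++ r ∷ ρ')) →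
                 length A < length (srwAux p (A ++ r ∷ ρ')) →
                 ∃₂ λ L H → A ≡ L ++ reverse H × Increasing (p ∷ L ++ r ∷ H)
srw-long⇒pivot [] ρ' _ (p<r ∷ []) _ = [] , [] , refl , (p<r ∷ []) ∷ [] ∷ []
srw-long⇒pivot (x ∷ A) {p} {r} ρ' (x∉ ∷ unique) (p<x ∷ []) long
  with head-compare (A ++ r ∷ ρ') (head-++ A (Allₚ.++⁻ˡ A x∉) (All.head (Allₚ.++⁻ʳ A x∉) ∷ []))
... | inj₁ descent
  with decRun-long⁻¹ A ρ' (length-∷⁻ (srwAux-descent (A ++ r ∷ ρ') descent) long)
...   | dec , r<xA , p<r =
  [] , reverse (x ∷ A) , sym (reverse-involutive (x ∷ A)) ,
  increasing-∷ p<r (All-reverse r<xA ∷ AllPairs-reverse dec)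
srw-long⇒pivot (x ∷ A) {p} {r} ρ' (x∉ ∷ unique) (p<x ∷ []) long | inj₂ ascent
  with srw-long⇒pivot A ρ' unique ascent (length-∷⁻ (srwAux-ascent (A ++ r ∷ ρ') ascent) long)
... | L , H , A≡ , inc = x ∷ L , H , cong (x ∷_) A≡ , increasing-∷ p<x inc

μ-sort-srw : ∀ A {r} ρ' → Unique (A ++ r ∷ ρ') → All (0 <_) (A ++ r ∷ ρ') →
             length A < length (srw (A ++ r ∷ ρ')) → μ (sort A , r ∷ ρ') ≡ A ++ r ∷ ρ'
μ-sort-srw A {r} ρ' u pos long with srw-long⇒pivot A ρ' u (Allₚ.take⁺ 1 pos) long
... | L , H , refl , _ ∷ inc = begin
  μ (sort (L ++ reverse H) , r ∷ ρ') ≡⟨ cong (λ α → μ (α , r ∷ ρ')) sorted ⟩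
  μ (L ++ H , r ∷ ρ')                ≡⟨ μ-pivot L H ρ' inc ⟩
  L ++ reverse H ++ r ∷ ρ'           ≡⟨ ++-assoc L (reverse H) (r ∷ ρ') ⟨
  (L ++ reverse H) ++ r ∷ ρ'         ∎
  where
  open ≡-Reasoning
  sorted = sort-↭-increasing (++⁺ˡ L (↭-reverse H)) (increasing-without-pivot L inc)

compl-pivot : ∀ n {r ρ'} → r ∈ range n →
              ∃₂ λ L H → compl n (r ∷ ρ') ≡ L ++ H × Increasing (0 ∷ L ++ r ∷ H)
compl-pivot n {r} {ρ'} r∈ = increasing-split (compl n (r ∷ ρ')) (compl-increasing n (r ∷ ρ'))
  (All.lookup (range-positive n) r∈) (λ r∈α → proj₂ (∈-compl⁻ {n} r∈α) (here refl))

μ-InT : ∀ n k x → InS n (suc k) x → InT n k (μ x)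
μ-InT n k (_ , r ∷ ρ') S@(_ , u , ρ⊆ , refl) with compl-pivot n {ρ' = ρ'} (All.head ρ⊆)
... | L , H , α≡ , inc@(_ ∷ inc′) = ↭-trans (μ-↭ α ρ) (compl-++-↭ n u ρ⊆) , (begin
  n ∸ k                               ≡⟨ pivot-position S ⟩
  suc (length α)                      ≡⟨ cong suc (trans (cong length α≡) (length-++ L)) ⟩
  suc (length L + length H)           ≤⟨ pivot⇒srw-long L H ρ' inc ⟩
  length (srw (L ++ reverse H ++ ρ))  ≡⟨ cong (length ∘ srw) μ≡ ⟨
  length (srw (μ (α , ρ)))            ∎)
  where
  open ≤-Reasoning
  ρ = r ∷ ρ'
  α = compl n ρ
  μ≡ = trans (cong (λ β → μ (β , ρ)) α≡) (μ-pivot L H ρ' inc′)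

ν-InS : ∀ {n k} → k < n → ∀ σ → InT n k σ → InS n (suc k) (ν n k σ)
ν-InS {n} {k} k<n σ (σ↭ , _) =
  length-drop-pivot k<n σ↭ , Uniqueₚ.drop⁺ j (↭-range⇒unique σ↭) ,
  Allₚ.drop⁺ j (All.tabulate (∈-resp-↭ σ↭)) , sort-take≡compl-drop j σ↭
  where j = n ∸ k ∸ 1

ν∘μ : ∀ n k x → InS n (suc k) x → ν n k (μ x) ≡ x
ν∘μ n k x@(_ , ρ) S@(_ , _ , _ , refl) = begin
  (sort (take j σ) , drop j σ)     ≡⟨ cong (_, drop j σ) (sort-take≡compl-drop j σ↭) ⟩
  (compl n (drop j σ) , drop j σ)  ≡⟨ cong (λ d → compl n d , d) drop≡ρ ⟩
  (compl n ρ , ρ)                  ∎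
  where
  open ≡-Reasoning
  j = n ∸ k ∸ 1
  σ = μ x
  σ↭ = proj₁ (μ-InT n k x S)
  drop≡ρ : drop j σ ≡ ρ
  drop≡ρ = trans (cong (λ i → drop i σ) (cong (_∸ 1) (pivot-position S))) (drop-μ (compl n ρ) ρ)

μ∘ν : ∀ {n k} → k < n → ∀ σ → InT n k σ → μ (ν n k σ) ≡ σ
μ∘ν {n} {k} k<n σ (σ↭ , long) with drop (n ∸ k ∸ 1) σ in drop≡
... | [] = ⊥-elim (0≢1+n (trans (cong length (sym drop≡)) (length-drop-pivot k<n σ↭)))
... | r ∷ ρ' = trans (μ-sort-srw A ρ' unique positive long′) (sym σ≡)
  where
  j = n ∸ k ∸ 1
  A = take j σ
  σ≡ : σ ≡ A ++ r ∷ ρ'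
  σ≡ = trans (sym (take++drop≡id j σ)) (cong (A ++_) drop≡)
  length-A : length A ≡ j
  length-A = trans (length-take j σ)
    (m≤n⇒m⊓n≡m (subst (j ≤_) (trans (pivot-split k<n) (sym (length-↭-range σ↭))) (m≤m+n j (suc k))))
  unique = subst Unique σ≡ (↭-range⇒unique σ↭)
  positive = subst (All (0 <_)) σ≡ (All-resp-↭ (↭-sym σ↭) (range-positive n))
  long′ : length A < length (srw (A ++ r ∷ ρ'))
  long′ = subst₂ (λ i τ → suc i ≤ length (srw τ)) (sym length-A) σ≡
            (subst (_≤ length (srw σ)) (∸-pivot (pivot-split k<n)) long)

des-μ : ∀ n k x → InS n (suc k) x → des (μ x) ≡ desPair x
des-μ n k (_ , r ∷ ρ') (_ , _ , ρ⊆ , refl) with compl-pivot n {ρ' = ρ'} (All.head ρ⊆)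
... | L , H , α≡ , _ ∷ inc = begin
  des (μ (α , ρ))             ≡⟨ cong (λ β → des (μ (β , ρ))) α≡ ⟩
  des (μ (L ++ H , ρ))        ≡⟨ cong des (μ-pivot L H ρ' inc) ⟩
  des (L ++ reverse H ++ ρ)   ≡⟨ des-pivot L H ρ' inc ⟩
  length H + des ρ            ≡⟨ +-comm (length H) (des ρ) ⟩
  des ρ + length H            ≡⟨ cong (des ρ +_) (countGt-pivot L inc) ⟨
  des ρ + countGt r (L ++ H)  ≡⟨ cong (λ β → des ρ + countGt r β) α≡ ⟨
  des ρ + countGt r α         ∎
  where
  open ≡-Reasoning
  ρ = r ∷ ρ'
  α = compl n ρ

-- The hypothesis 1 ≤ n is implied by k < n.
theorem5p1 : (n k : ℕ) → 1 ≤ n → k < n →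
    ((x : Pair) → InS n (suc k) x → InT n k (μ x))
    × ((σ : List ℕ) → InT n k σ → InS n (suc k) (ν n k σ))
    × ((x : Pair) → InS n (suc k) x → ν n k (μ x) ≡ x)
    × ((σ : List ℕ) → InT n k σ → μ (ν n k σ) ≡ σ)
    × ((x : Pair) → InS n (suc k) x → des (μ x) ≡ desPair x)
theorem5p1 n k _ k<n = μ-InT n k , ν-InS k<n , ν∘μ n k , μ∘ν k<n , des-μ n k
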